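{- Let $\sigma : \mathcal{A}^* \to S$ be an abstract shape. Then the relation $\sim_\sigma$ is a congruence on the free monoid $\mathcal{A}^*$.
   Context: $\mathcal{A} = \{1,2,3,\ldots\}$ with the usual order; $\mathcal{A}^*$ is the free monoid over $\mathcal{A}$. $\mathrm{wt}(u) = (|u|_1,|u|_2,\ldots)$ where $|u|_a$ counts occurrences of $a$ in $u$. The standardization $\mathrm{std}(u)$ of a word of length $k$ replaces the occurrences of $1$ from left to right by $1,2,\ldots$, then the occurrences of $2$ from left to right by the next integers, and so on. An abstract shape is a map $\sigma : \mathcal{A}^* \to S$ (for some set $S$) such that (S1) $\sigma(u) = \sigma(\mathrm{std}(u))$ for all $u \in \mathcal{A}^*$, and (S2) for all $u,v \in \mathcal{A}^*$ and $a \in \mathcal{A}$, if $\mathrm{wt}(u) = \mathrm{wt}(v)$ and $\sigma(u) = \sigma(v)$ then $\sigma(ua) = \sigma(va)$ and $\sigma(au) = \sigma(av)$. For $i \in \mathbb{N}$ the quasi-Kashiwara operators $\ddot e_i,\ddot f_i$ are partial maps on $\mathcal{A}^*$: if $u$ contains a letter $i+1$ somewhere to the left of a letter $i$, both are undefined; otherwise $\ddot e_i(u)$ replaces the leftmost $i+1$ by $i$ (undefined if none), and $\ddot f_i(u)$ replaces the rightmost $i$ by $i+1$ (undefined if none). The quasi-crystal graph $\Gamma(\mathrm{hypo})$ has vertex set $\mathcal{A}^*$ and an edge $u\to v$ labelled $i$ iff $v = \ddot f_i(u)$; $\Gamma(\mathrm{hypo},u)$ is the connected component containing $u$. A quasi-crystal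 isomorphism is an isomorphism of labelled directed graphs between connected components; it is shape-preserving (with respect to $\sigma$) if $\sigma(w) = \sigma(\theta(w))$ for all $w$ in its domain. Define $u \sim_\sigma v$ iff there is a shape-preserving quasi-crystal isomorphism $\theta : \Gamma(\mathrm{hypo},u) \to \Gamma(\mathrm{hypo},v)$ with $\theta(u) = v$. -}

module Defs where

open import Data.Nat using (ℕ; zero; suc; _+_; _≡ᵇ_; _<ᵇ_)
open import Data.Bool using (Bool; true; false; if_then_else_; _∨_)
open import Data.List using (List; []; _∷_; _++_; [_])
open import Data.Maybe using (Maybe; just; nothing)
open import Data.Product using (Σ; _×_; ∃)
open import Relation.Binary.PropositionalEquality using (_≡_)
open import Relation.Binary.Construct.Closure.Equivalence using (EqClosure)
open import Relation.Binary.Structures using (IsEquivalence)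

-- Letters: the paper's alphabet A = {1,2,3,...} is encoded by ℕ,
-- the natural number a standing for the letter a+1 (order preserved).
Letter : Set
Letter = ℕ

Word : Set
Word = List Letter

occ : Letter → Word → ℕ
occ a [] = 0
occ a (b ∷ u) = (if a ≡ᵇ b then 1 else 0) + occ a u

countLt : Letter → Word → ℕ
countLt a [] = 0
countLt a (b ∷ u) = (if b <ᵇ a then 1 else 0) + countLt a u

SameWt : Word → Word → Set
SameWt u v = ∀ (a : Letter) → occ a u ≡ occ a v

-- Standardization: the letter at position j of u is sent to
--   #{letters of u smaller than u_j} + #{earlier occurrences of u_j} (+1 in the paper's
--   1-based alphabet, which is exactly our encoding shift).
stdGo : Word → Word → Word → Word
stdGo whole pre [] = []
stdGo whole pre (a ∷ rest) = (countLt a whole + occ a pre) ∷ stdGo whole (pre ++ [ a ]) rest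

std : Word → Word
std u = stdGo u [] u

record IsAbstractShape {S : Set} (σ : Word → S) : Set where
  field
    S1 : ∀ (u : Word) → σ u ≡ σ (std u)
    S2 : ∀ (u v : Word) (a : Letter) → SameWt u v → σ u ≡ σ v →
           (σ (u ++ [ a ]) ≡ σ (v ++ [ a ])) × (σ (a ∷ u) ≡ σ (a ∷ v))

elem : Letter → Word → Bool
elem a [] = false
elem a (b ∷ u) = (a ≡ᵇ b) ∨ elem a u

blocked : ℕ → Word → Bool
blocked i [] = false
blocked i (a ∷ u) = if a ≡ᵇ suc i then elem i u ∨ blocked i u else blocked i u

replaceFirst : Letter → Letter → Word → Maybe Word
replaceFirst b c [] = nothing
replaceFirst b c (a ∷ u) with b ≡ᵇ a
... | true = just (c ∷ u)
... | false with replaceFirst b c u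
...   | just u' = just (a ∷ u')
...   | nothing = nothing

replaceLast : Letter → Letter → Word → Maybe Word
replaceLast b c [] = nothing
replaceLast b c (a ∷ u) with replaceLast b c u
... | just u' = just (a ∷ u')
... | nothing = if b ≡ᵇ a then just (c ∷ u) else nothing

ë : ℕ → Word → Maybe Word
ë i u = if blocked i u then nothing else replaceFirst (suc i) i u

f̈ : ℕ → Word → Maybe Word
f̈ i u = if blocked i u then nothing else replaceLast i (suc i) u

Edge : ℕ → Word → Word → Set
Edge i u w = f̈ i u ≡ just w

AnyEdge : Word → Word → Set
AnyEdge u w = ∃ λ i → Edge i u w

InComp : Word → Word → Set
InComp u w = EqClosure AnyEdge u w

-- A shape-preserving quasi-crystal isomorphism θ : Γ(hypo,u) → Γ(hypo,v)
-- with θ(u) = v, given by θ and its inverse θ⁻ (only their values on the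
-- respective components matter).
record ShapeIso {S : Set} (σ : Word → S) (u v : Word) : Set where
  field
    θ θ⁻ : Word → Word
    θ-comp  : ∀ w → InComp u w → InComp v (θ w)
    θ⁻-comp : ∀ w → InComp v w → InComp u (θ⁻ w)
    θ⁻θ : ∀ w → InComp u w → θ⁻ (θ w) ≡ w
    θθ⁻ : ∀ w → InComp v w → θ (θ⁻ w) ≡ w
    edge-pres : ∀ i w w' → InComp u w → InComp u w' → Edge i w w' → Edge i (θ w) (θ w')
    edge-refl : ∀ i w w' → InComp u w → InComp u w' → Edge i (θ w) (θ w') → Edge i w w'
    shape : ∀ w → InComp u w → σ w ≡ σ (θ w)
    base : θ u ≡ v

_∼[_]_ : {S : Set} → Word → (Word → S) → Word → Set
u ∼[ σ ] v = ShapeIso σ u v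

record IsCongruence (R : Word → Word → Set) : Set where
  field
    isEquivalence : IsEquivalence R
    compatible : ∀ {u v u' v'} → R u v → R u' v' → R (u ++ u') (v ++ v')

-- ∼σ is an equivalence because identity, inverse and composite isomorphisms are again
-- shape-preserving isomorphisms. For compatibility with concatenation, Γ(hypo) behaves like a
-- tensor product: an edge out of x ++ y changes exactly one factor, x only if y has no letter i
-- and y only if x has no letter i+1. So Γ(u ++ u') consists of the words c ++ d with c ∈ Γ(u) and
-- d ∈ Γ(u'), and θ ++ θ' is an isomorphism Γ(u ++ u') → Γ(v ++ v') provided θ and θ' preserve
-- weights. They do: following edges labelled above j, which fix |w|ⱼ, one reaches a word y with
-- no letter j+1; from y there are |y|ⱼ successive f̈ⱼ-edges, while from any word z there are at
-- most |z|ⱼ, so |θ y|ⱼ ≥ |y|ⱼ, and the inverse gives the converse. Shapes are then preserved by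
-- iterating (S2).

module Submission where

open import Defs

open import Data.Bool using (true; false; _∨_; _∧_)
open import Data.Bool.Properties using (∨-conicalˡ; ∨-conicalʳ; ∧-zeroʳ)
open import Data.List using (List; []; _∷_; _++_; [_]; length; take; drop)
open import Data.List.Properties using (length-++; length-take; take++drop≡id; ++-assoc; ++-identityʳ)
open import Data.Maybe using (just; nothing)
import Data.Maybe as Maybe
open import Data.Maybe.Properties using (just-injective)
open import Data.Nat using (ℕ; zero; suc; _+_; _≡ᵇ_; _≤_; _<_; z≤n; s≤s; z<s)
open import Data.Nat.ListAction using (sum)
open import Data.Nat.Properties
open import Data.Product using (∃; ∃₂; _×_; _,_; proj₁; proj₂; map₂)
open import Relation.Nullary using (contradiction)
open import Relation.Nullary.Decidable using (proof)
open import Relation.Nullary.Reflects using (Reflects; ofʸ; ofⁿ)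
open import Relation.Binary.PropositionalEquality hiding ([_])
open import Relation.Binary.Construct.Closure.ReflexiveTransitive using (Star; ε; _◅_; _◅◅_)
  renaming (map to mapStar)
open import Relation.Binary.Construct.Closure.Symmetric using (SymClosure; fwd; bwd)

≡ᵇ-reflects : ∀ m n → Reflects (m ≡ n) (m ≡ᵇ n)
≡ᵇ-reflects m n = proof (m ≟ n)

≡ᵇ-comm : ∀ m n → (m ≡ᵇ n) ≡ (n ≡ᵇ m)
≡ᵇ-comm zero    zero    = refl
≡ᵇ-comm zero    (suc n) = refl
≡ᵇ-comm (suc m) zero    = refl
≡ᵇ-comm (suc m) (suc n) = ≡ᵇ-comm m n

occ-∷-≡ : ∀ a x → occ a (a ∷ x) ≡ suc (occ a x)
occ-∷-≡ a x with a ≡ᵇ a | ≡ᵇ-reflects a a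
... | true  | _        = refl
... | false | ofⁿ a≢a = contradiction refl a≢a

occ-∷-≢ : ∀ {j a} x → j ≢ a → occ j (a ∷ x) ≡ occ j x
occ-∷-≢ {j} {a} x j≢a with j ≡ᵇ a | ≡ᵇ-reflects j a
... | true  | ofʸ j≡a = contradiction j≡a j≢a
... | false | _        = refl

occ-++ : ∀ a x y → occ a (x ++ y) ≡ occ a x + occ a y
occ-++ a []      y = refl
occ-++ a (b ∷ x) y = trans (cong (_ +_) (occ-++ a x y)) (sym (+-assoc _ (occ a x) (occ a y)))

elem-++ : ∀ a x y → elem a (x ++ y) ≡ elem a x ∨ elem a y
elem-++ a []      y = refl
elem-++ a (b ∷ x) y with a ≡ᵇ b
... | true  = refl
... | false = elem-++ a x y

elem≡false⇒occ≡0 : ∀ a x → elem a x ≡ false → occ a x ≡ 0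
elem≡false⇒occ≡0 a []      _ = refl
elem≡false⇒occ≡0 a (b ∷ x) e with a ≡ᵇ b
... | false = elem≡false⇒occ≡0 a x e

occ≡0⇒elem≡false : ∀ a x → occ a x ≡ 0 → elem a x ≡ false
occ≡0⇒elem≡false a []      _ = refl
occ≡0⇒elem≡false a (b ∷ x) o with a ≡ᵇ b
... | false = occ≡0⇒elem≡false a x o

sum<⇒occ≡0 : ∀ a x → sum x < a → occ a x ≡ 0
sum<⇒occ≡0 a []      _ = refl
sum<⇒occ≡0 a (b ∷ x) lt = trans (occ-∷-≢ x a≢b) (sum<⇒occ≡0 a x (≤-<-trans (m≤n+m (sum x) b) lt))
  where a≢b : a ≢ b
        a≢b refl = <-irrefl refl (≤-<-trans (m≤m+n b (sum x)) lt)

blocked-++ : ∀ i x y → blocked i (x ++ y) ≡ blocked i x ∨ (elem (suc i) x ∧ elem i y) ∨ blocked i y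
blocked-++ i []      y = refl
blocked-++ i (a ∷ x) y rewrite ≡ᵇ-comm (suc i) a with a ≡ᵇ suc i
... | false = blocked-++ i x y
... | true  rewrite elem-++ i x y | blocked-++ i x y =
  absorb (elem i x) (elem i y) (blocked i x) (elem (suc i) x) (blocked i y)
  where
  absorb : ∀ e f b s d → (e ∨ f) ∨ b ∨ (s ∧ f) ∨ d ≡ (e ∨ b) ∨ f ∨ d
  absorb true  _     _     _     _ = refl
  absorb false true  true  _     _ = refl
  absorb false true  false _     _ = refl
  absorb false false b     true  d = refl
  absorb false false b     false d = refl

unblocked-++ˡ : ∀ i x y → blocked i (x ++ y) ≡ false → blocked i x ≡ false
unblocked-++ˡ i x y ub = ∨-conicalˡ (blocked i x) _ (trans (sym (blocked-++ i x y)) ub)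

unblocked-++ʳ : ∀ i x y → blocked i (x ++ y) ≡ false → blocked i y ≡ false
unblocked-++ʳ i x y ub =
  ∨-conicalʳ (elem (suc i) x ∧ elem i y) _ (∨-conicalʳ (blocked i x) _ (trans (sym (blocked-++ i x y)) ub))

unblocked-++-crossing : ∀ i x y → blocked i (x ++ y) ≡ false → elem (suc i) x ∧ elem i y ≡ false
unblocked-++-crossing i x y ub =
  ∨-conicalˡ _ (blocked i y) (∨-conicalʳ (blocked i x) _ (trans (sym (blocked-++ i x y)) ub))

unblocked-++ : ∀ i x y → blocked i x ≡ false → elem (suc i) x ∧ elem i y ≡ false → blocked i y ≡ false →
               blocked i (x ++ y) ≡ false
unblocked-++ i x y ux c uy rewrite blocked-++ i x y | ux | c | uy = refl

no-i⇒unblocked : ∀ i x → occ i x ≡ 0 → blocked i x ≡ false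
no-i⇒unblocked i []      _ = refl
no-i⇒unblocked i (a ∷ x) o with i ≡ᵇ a
... | false with a ≡ᵇ suc i
...   | true  rewrite occ≡0⇒elem≡false i x o = no-i⇒unblocked i x o
...   | false = no-i⇒unblocked i x o

no-suc-i⇒unblocked : ∀ i x → occ (suc i) x ≡ 0 → blocked i x ≡ false
no-suc-i⇒unblocked i []      _ = refl
no-suc-i⇒unblocked i (a ∷ x) o rewrite ≡ᵇ-comm a (suc i) with suc i ≡ᵇ a
... | false = no-suc-i⇒unblocked i x o

replaceLast-++ʳ : ∀ b c x {y y'} → replaceLast b c y ≡ just y' → replaceLast b c (x ++ y) ≡ just (x ++ y')
replaceLast-++ʳ b c []      r = r
replaceLast-++ʳ b c (a ∷ x) {y} r rewrite replaceLast-++ʳ b c x {y} r = refl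

replaceLast-++ˡ : ∀ b c x {y} → replaceLast b c y ≡ nothing →
                  replaceLast b c (x ++ y) ≡ Maybe.map (_++ y) (replaceLast b c x)
replaceLast-++ˡ b c []      r = r
replaceLast-++ˡ b c (a ∷ x) {y} r rewrite replaceLast-++ˡ b c x {y} r with replaceLast b c x
... | just _  = refl
... | nothing with b ≡ᵇ a
...   | true  = refl
...   | false = refl

replaceLast≡nothing⇒occ≡0 : ∀ b c x → replaceLast b c x ≡ nothing → occ b x ≡ 0
replaceLast≡nothing⇒occ≡0 b c []      _ = refl
replaceLast≡nothing⇒occ≡0 b c (a ∷ x) r with replaceLast b c x in rx
... | nothing with b ≡ᵇ a
...   | false = replaceLast≡nothing⇒occ≡0 b c x rx

occ≡0⇒replaceLast≡nothing : ∀ b c x → occ b x ≡ 0 → replaceLast b c x ≡ nothing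
occ≡0⇒replaceLast≡nothing b c []      _ = refl
occ≡0⇒replaceLast≡nothing b c (a ∷ x) o with b ≡ᵇ a in ba
... | false rewrite occ≡0⇒replaceLast≡nothing b c x o | ba = refl

replaceLast-just : ∀ b c x {y} → replaceLast b c x ≡ just y →
                   ∃₂ λ p q → x ≡ p ++ b ∷ q × y ≡ p ++ c ∷ q × occ b q ≡ 0
replaceLast-just b c (a ∷ x) r with replaceLast b c x in rx
replaceLast-just b c (a ∷ x) refl | just _ with replaceLast-just b c x rx
... | p , q , refl , refl , o = a ∷ p , q , refl , refl , o
replaceLast-just b c (a ∷ x) r | nothing with b ≡ᵇ a | ≡ᵇ-reflects b a
replaceLast-just b c (a ∷ x) refl | nothing | true | ofʸ refl =
  [] , x , refl , refl , replaceLast≡nothing⇒occ≡0 b c x rx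

Edge-unblocked : ∀ i x {y} → Edge i x y → blocked i x ≡ false
Edge-unblocked i x e with blocked i x
... | false = refl

Edge-replaceLast : ∀ i x {y} → Edge i x y → replaceLast i (suc i) x ≡ just y
Edge-replaceLast i x e with blocked i x
... | false = e

Edge-intro : ∀ i x {y} → blocked i x ≡ false → replaceLast i (suc i) x ≡ just y → Edge i x y
Edge-intro i x ub r rewrite ub = r

Edge-exists : ∀ i x → blocked i x ≡ false → 0 < occ i x → ∃ (Edge i x)
Edge-exists i x ub pos rewrite ub with replaceLast i (suc i) x in r
... | just y  = y , refl
... | nothing = contradiction (replaceLast≡nothing⇒occ≡0 i (suc i) x r) (>⇒≢ pos)

Edge-split : ∀ i x {y} → Edge i x y → ∃₂ λ p q → x ≡ p ++ i ∷ q × y ≡ p ++ suc i ∷ q × occ i q ≡ 0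
Edge-split i x e = replaceLast-just i (suc i) x (Edge-replaceLast i x e)

Edge-length : ∀ i x {y} → Edge i x y → length y ≡ length x
Edge-length i x e with Edge-split i x e
... | p , q , refl , refl , _ = trans (length-++ p) (sym (length-++ p))

Edge-occ : ∀ i x {y} → Edge i x y → occ i x ≡ suc (occ i y)
Edge-occ i x e with Edge-split i x e
... | p , q , refl , refl , _ = begin
  occ i (p ++ i ∷ q)                ≡⟨ occ-++ i p (i ∷ q) ⟩
  occ i p + occ i (i ∷ q)           ≡⟨ cong (occ i p +_) (occ-∷-≡ i q) ⟩
  occ i p + suc (occ i q)           ≡⟨ +-suc (occ i p) (occ i q) ⟩
  suc (occ i p + occ i q)           ≡⟨ cong (λ n → suc (occ i p + n)) (occ-∷-≢ q (<⇒≢ (n<1+n i))) ⟨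
  suc (occ i p + occ i (suc i ∷ q)) ≡⟨ cong suc (occ-++ i p (suc i ∷ q)) ⟨
  suc (occ i (p ++ suc i ∷ q))      ∎
  where open ≡-Reasoning

Edge-occ-≢ : ∀ i x {y j} → Edge i x y → j ≢ i → j ≢ suc i → occ j x ≡ occ j y
Edge-occ-≢ i x {j = j} e j≢i j≢1+i with Edge-split i x e
... | p , q , refl , refl , _ = begin
  occ j (p ++ i ∷ q)           ≡⟨ occ-++ j p (i ∷ q) ⟩
  occ j p + occ j (i ∷ q)      ≡⟨ cong (occ j p +_) (occ-∷-≢ q j≢i) ⟩
  occ j p + occ j q            ≡⟨ cong (occ j p +_) (occ-∷-≢ q j≢1+i) ⟨
  occ j p + occ j (suc i ∷ q)  ≡⟨ occ-++ j p (suc i ∷ q) ⟨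
  occ j (p ++ suc i ∷ q)       ∎
  where open ≡-Reasoning

Edge-target-unblocked : ∀ i x {y} → Edge i x y → blocked i y ≡ false
Edge-target-unblocked i x e with Edge-split i x e
... | p , q , refl , refl , o =
  unblocked-++ i p (suc i ∷ q) (unblocked-++ˡ i p (i ∷ q) (Edge-unblocked i (p ++ i ∷ q) e))
    (trans (cong (elem (suc i) p ∧_) (occ≡0⇒elem≡false i (suc i ∷ q) no-i)) (∧-zeroʳ _))
    (no-i⇒unblocked i (suc i ∷ q) no-i)
  where no-i : occ i (suc i ∷ q) ≡ 0
        no-i = trans (occ-∷-≢ q (<⇒≢ (n<1+n i))) o

-- Edges and components of a concatenation

data EdgeOnFactor (i : ℕ) (x y z : Word) : Set where
  onˡ : ∀ {x'} → Edge i x x' → occ i y ≡ 0 → z ≡ x' ++ y → EdgeOnFactor i x y z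
  onʳ : ∀ {y'} → Edge i y y' → occ (suc i) x ≡ 0 → z ≡ x ++ y' → EdgeOnFactor i x y z

Edge-++⁻ : ∀ i x y {z} → Edge i (x ++ y) z → EdgeOnFactor i x y z
Edge-++⁻ i x y {z} e = split (Edge-unblocked i (x ++ y) e) (Edge-replaceLast i (x ++ y) e)
  where
  split : blocked i (x ++ y) ≡ false → replaceLast i (suc i) (x ++ y) ≡ just z → EdgeOnFactor i x y z
  split ub r with replaceLast i (suc i) y in ry
  ... | just y' = onʳ (Edge-intro i y (unblocked-++ʳ i x y ub) ry) no-suc-i
                      (just-injective (trans (sym r) (replaceLast-++ʳ i (suc i) x ry)))
    where
    no-suc-i : occ (suc i) x ≡ 0
    no-suc-i with elem (suc i) x in ex
    ... | false = elem≡false⇒occ≡0 (suc i) x ex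
    ... | true  = contradiction
      (trans (sym ry) (occ≡0⇒replaceLast≡nothing i (suc i) y (elem≡false⇒occ≡0 i y
        (trans (cong (_∧ elem i y) (sym ex)) (unblocked-++-crossing i x y ub)))))
      λ ()
  ... | nothing with replaceLast i (suc i) x in rx | replaceLast-++ˡ i (suc i) x ry
  ...   | just x' | r' = onˡ (Edge-intro i x (unblocked-++ˡ i x y ub) rx)
                             (replaceLast≡nothing⇒occ≡0 i (suc i) y ry) (just-injective (trans (sym r) r'))
  ...   | nothing | r' = contradiction (trans (sym r) r') λ ()

Edge-++ˡ : ∀ i x y {x'} → Edge i x x' → occ i y ≡ 0 → Edge i (x ++ y) (x' ++ y)
Edge-++ˡ i x y e o = Edge-intro i (x ++ y)
  (unblocked-++ i x y (Edge-unblocked i x e)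
    (trans (cong (elem (suc i) x ∧_) (occ≡0⇒elem≡false i y o)) (∧-zeroʳ _))
    (no-i⇒unblocked i y o))
  (trans (replaceLast-++ˡ i (suc i) x (occ≡0⇒replaceLast≡nothing i (suc i) y o))
         (cong (Maybe.map (_++ y)) (Edge-replaceLast i x e)))

Edge-++ʳ : ∀ i x y {y'} → Edge i y y' → occ (suc i) x ≡ 0 → Edge i (x ++ y) (x ++ y')
Edge-++ʳ i x y e o = Edge-intro i (x ++ y)
  (unblocked-++ i x y (no-suc-i⇒unblocked i x o)
    (cong (_∧ elem i y) (occ≡0⇒elem≡false (suc i) x o))
    (Edge-unblocked i y e))
  (replaceLast-++ʳ i (suc i) x (Edge-replaceLast i y e))

take-length-++ : ∀ {A : Set} (x y : List A) → take (length x) (x ++ y) ≡ x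
take-length-++ []      y = refl
take-length-++ (a ∷ x) y = cong (a ∷_) (take-length-++ x y)

drop-length-++ : ∀ {A : Set} (x y : List A) → drop (length x) (x ++ y) ≡ y
drop-length-++ []      y = refl
drop-length-++ (a ∷ x) y = drop-length-++ x y

++-injective : ∀ {A : Set} (x x' : List A) {y y' : List A} →
               length x ≡ length x' → x ++ y ≡ x' ++ y' → x ≡ x' × y ≡ y'
++-injective x x' {y} {y'} l eq =
  trans (sym (take-length-++ x y)) (trans (cong₂ take l eq) (take-length-++ x' y')) ,
  trans (sym (drop-length-++ x y)) (trans (cong₂ drop l eq) (drop-length-++ x' y'))

Step : Word → Word → Set
Step = SymClosure AnyEdge

data StepOnFactor (x y z : Word) : Set where
  stepˡ : ∀ {x'} → Step x x' → z ≡ x' ++ y → StepOnFactor x y z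
  stepʳ : ∀ {y'} → Step y y' → z ≡ x ++ y' → StepOnFactor x y z

Edge-into-++⁻ : ∀ i x y c d → length c ≡ length x → Edge i (c ++ d) (x ++ y) → StepOnFactor x y (c ++ d)
Edge-into-++⁻ i x y c d l e with Edge-++⁻ i c d e
... | onˡ {c'} e' _ eq with ++-injective x c' {y} (trans (sym l) (sym (Edge-length i c e'))) eq
...   | refl , refl = stepˡ (bwd (i , e')) refl
Edge-into-++⁻ i x y c d l e | onʳ e' _ eq with ++-injective x c {y} (sym l) eq
...   | refl , refl = stepʳ (bwd (i , e')) refl

Step-++⁻ : ∀ x y {z} → Step (x ++ y) z → StepOnFactor x y z
Step-++⁻ x y (fwd (i , e)) with Edge-++⁻ i x y e
... | onˡ e' _ eq = stepˡ (fwd (i , e')) eq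
... | onʳ e' _ eq = stepʳ (fwd (i , e')) eq
Step-++⁻ x y {z} (bwd (i , e)) =
  subst (StepOnFactor x y) (take++drop≡id n z)
    (Edge-into-++⁻ i x y (take n z) (drop n z) length-prefix
      (subst (λ t → Edge i t (x ++ y)) (sym (take++drop≡id n z)) e))
  where
  n = length x
  length-prefix : length (take n z) ≡ n
  length-prefix = trans (length-take n z)
    (m≤n⇒m⊓n≡m (subst (n ≤_) (trans (sym (length-++ x)) (Edge-length i z e)) (m≤m+n n (length y))))

InComp-step : ∀ {u a b} → InComp u a → Step a b → InComp u b
InComp-step c s = c ◅◅ s ◅ ε

InComp-length : ∀ {u w} → InComp u w → length w ≡ length u
InComp-length ε = refl
InComp-length {u} (fwd (i , e) ◅ c) = trans (InComp-length c) (Edge-length i u e)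
InComp-length (_◅_ {j = z} (bwd (i , e)) c) = trans (InComp-length c) (sym (Edge-length i z e))

InComp-++⁻ : ∀ u u' {w} → InComp (u ++ u') w → ∃₂ λ c d → w ≡ c ++ d × InComp u c × InComp u' d
InComp-++⁻ u u' = go ε ε
  where
  go : ∀ {a b w} → InComp u a → InComp u' b → Star Step (a ++ b) w →
       ∃₂ λ c d → w ≡ c ++ d × InComp u c × InComp u' d
  go {a} {b} ca cb ε = a , b , refl , ca , cb
  go {a} {b} ca cb (s ◅ p) with Step-++⁻ a b s
  ... | stepˡ s' refl = go (InComp-step ca s') cb p
  ... | stepʳ s' refl = go ca (InComp-step cb s') p

-- Edge-preserving maps preserve weights

EdgePreserving : Word → (Word → Word) → Set
EdgePreserving u θ = ∀ i w w' → InComp u w → InComp u w' → Edge i w w' → Edge i (θ w) (θ w')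

InComp-map : ∀ {u θ w} → EdgePreserving u θ → InComp u w → InComp (θ u) (θ w)
InComp-map {u} {θ} pres = go ε
  where
  go : ∀ {x w} → InComp u x → Star Step x w → Star Step (θ x) (θ w)
  go cx ε = ε
  go {x} cx (fwd (i , e) ◅ p) = fwd (i , pres i x _ cx cz e) ◅ go cz p
    where cz = InComp-step cx (fwd (i , e))
  go {x} cx (bwd (i , e) ◅ p) = bwd (i , pres i _ x cz cx e) ◅ go cz p
    where cz = InComp-step cx (bwd (i , e))

Walk : (ℕ → Set) → Word → Word → Set
Walk P = Star (λ x y → ∃ λ i → P i × Edge i x y)

Walk-map : ∀ {u θ P x y} → EdgePreserving u θ → InComp u x → Walk P x y → InComp u y × Walk P (θ x) (θ y)
Walk-map pres cx ε = cx , ε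
Walk-map {x = x} pres cx ((i , Pi , e) ◅ p) =
  map₂ ((i , Pi , pres i x _ cx cz e) ◅_) (Walk-map pres cz p)
  where cz = InComp-step cx (fwd (i , e))

occ-Walk-above : ∀ {j x y} → Walk (j <_) x y → occ j x ≡ occ j y
occ-Walk-above ε = refl
occ-Walk-above {x = x} ((i , j<i , e) ◅ p) =
  trans (Edge-occ-≢ i x e (<⇒≢ j<i) (<⇒≢ (m<n⇒m<1+n j<i))) (occ-Walk-above p)

drain : ∀ {P} i x → P i → blocked i x ≡ false → ∃ λ y → Walk P x y × occ i y ≡ 0
drain {P} i x Pi ub = go (occ i x) x refl ub
  where
  go : ∀ n x → occ i x ≡ n → blocked i x ≡ false → ∃ λ y → Walk P x y × occ i y ≡ 0
  go zero    x o ub = x , ε , o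
  go (suc n) x o ub with Edge-exists i x ub (subst (0 <_) (sym o) z<s)
  ... | x' , e with go n x' (suc-injective (trans (sym (Edge-occ i x e)) o)) (Edge-target-unblocked i x e)
  ...   | y , p , o' = y , (i , Pi , e) ◅ p , o'

drain-above : ∀ j x → ∃ λ y → Walk (j <_) x y × occ (suc j) y ≡ 0
drain-above j x =
  go (sum x) j x (λ a lt → sum<⇒occ≡0 a x (≤-<-trans (m≤m+n (sum x) j) lt))
  where
  -- letters are cleared from the top down: draining j+1 requires j+2 to be absent already
  go : ∀ n j x → (∀ a → n + j < a → occ a x ≡ 0) → ∃ λ y → Walk (j <_) x y × occ (suc j) y ≡ 0
  go zero    j x bound = x , ε , bound (suc j) (n<1+n j)
  go (suc n) j x bound with go n (suc j) x (λ a lt → bound a (subst (_< a) (+-suc n j) lt))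
  ... | y₁ , p₁ , o₁ with drain (suc j) y₁ (n<1+n j) (no-suc-i⇒unblocked (suc j) y₁ o₁)
  ...   | y , p , o = y , mapStar (λ (i , j<i , e) → i , <-trans (n<1+n j) j<i , e) p₁ ◅◅ p , o

occ-≤-map-unblocked : ∀ {u θ} → EdgePreserving u θ → ∀ j x → InComp u x → blocked j x ≡ false →
                      occ j x ≤ occ j (θ x)
occ-≤-map-unblocked {u} {θ} pres j x cx ub = go (occ j x) x refl ub cx
  where
  go : ∀ n x → occ j x ≡ n → blocked j x ≡ false → InComp u x → n ≤ occ j (θ x)
  go zero    x o ub cx = z≤n
  go (suc n) x o ub cx with Edge-exists j x ub (subst (0 <_) (sym o) z<s)
  ... | x' , e = subst (suc n ≤_) (sym (Edge-occ j (θ x) (pres j x x' cx cx' e)))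
                   (s≤s (go n x' (suc-injective (trans (sym (Edge-occ j x e)) o)) (Edge-target-unblocked j x e) cx'))
    where cx' = InComp-step cx (fwd (j , e))

occ-≤-map : ∀ {u θ} → EdgePreserving u θ → ∀ j {x} → InComp u x → occ j x ≤ occ j (θ x)
occ-≤-map {u} {θ} pres j {x} cx with drain-above j x
... | y , p , o with Walk-map pres cx p
...   | cy , p' = begin
  occ j x      ≡⟨ occ-Walk-above p ⟩
  occ j y      ≤⟨ occ-≤-map-unblocked pres j y cy (no-suc-i⇒unblocked j y o) ⟩
  occ j (θ y)  ≡⟨ occ-Walk-above p' ⟨
  occ j (θ x)  ∎
  where open ≤-Reasoning

module _ {S : Set} {σ : Word → S} where

  ShapeIso-refl : ∀ {u} → ShapeIso σ u u
  ShapeIso-refl = record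
    { θ = λ w → w ; θ⁻ = λ w → w
    ; θ-comp = λ _ c → c ; θ⁻-comp = λ _ c → c
    ; θ⁻θ = λ _ _ → refl ; θθ⁻ = λ _ _ → refl
    ; edge-pres = λ _ _ _ _ _ e → e ; edge-refl = λ _ _ _ _ _ e → e
    ; shape = λ _ _ → refl ; base = refl
    }

  ShapeIso-sym : ∀ {u v} → ShapeIso σ u v → ShapeIso σ v u
  ShapeIso-sym {u} I = record
    { θ = θ⁻ ; θ⁻ = θ
    ; θ-comp = θ⁻-comp ; θ⁻-comp = θ-comp
    ; θ⁻θ = θθ⁻ ; θθ⁻ = θ⁻θ
    ; edge-pres = λ i w w' c c' e → edge-refl i (θ⁻ w) (θ⁻ w') (θ⁻-comp w c) (θ⁻-comp w' c')
                    (subst₂ (Edge i) (sym (θθ⁻ w c)) (sym (θθ⁻ w' c')) e)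
    ; edge-refl = λ i w w' c c' e → subst₂ (Edge i) (θθ⁻ w c) (θθ⁻ w' c')
                    (edge-pres i (θ⁻ w) (θ⁻ w') (θ⁻-comp w c) (θ⁻-comp w' c') e)
    ; shape = λ w c → sym (trans (shape (θ⁻ w) (θ⁻-comp w c)) (cong σ (θθ⁻ w c)))
    ; base = trans (cong θ⁻ (sym base)) (θ⁻θ u ε)
    }
    where open ShapeIso I

  ShapeIso-trans : ∀ {u v x} → ShapeIso σ u v → ShapeIso σ v x → ShapeIso σ u x
  ShapeIso-trans I J = record
    { θ = λ w → J.θ (I.θ w) ; θ⁻ = λ w → I.θ⁻ (J.θ⁻ w)
    ; θ-comp = λ w c → J.θ-comp _ (I.θ-comp w c)
    ; θ⁻-comp = λ w c → I.θ⁻-comp _ (J.θ⁻-comp w c)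
    ; θ⁻θ = λ w c → trans (cong I.θ⁻ (J.θ⁻θ _ (I.θ-comp w c))) (I.θ⁻θ w c)
    ; θθ⁻ = λ w c → trans (cong J.θ (I.θθ⁻ _ (J.θ⁻-comp w c))) (J.θθ⁻ w c)
    ; edge-pres = λ i w w' c c' e →
        J.edge-pres i _ _ (I.θ-comp w c) (I.θ-comp w' c') (I.edge-pres i w w' c c' e)
    ; edge-refl = λ i w w' c c' e →
        I.edge-refl i w w' c c' (J.edge-refl i _ _ (I.θ-comp w c) (I.θ-comp w' c') e)
    ; shape = λ w c → trans (I.shape w c) (J.shape _ (I.θ-comp w c))
    ; base = trans (cong J.θ I.base) J.base
    }
    where module I = ShapeIso I
          module J = ShapeIso J

  ShapeIso-intro : ∀ {u v} (θ θ⁻ : Word → Word) → EdgePreserving u θ → EdgePreserving v θ⁻ → θ u ≡ v →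
                   (∀ w → InComp u w → θ⁻ (θ w) ≡ w) → (∀ w → InComp v w → θ (θ⁻ w) ≡ w) →
                   (∀ w → InComp u w → σ w ≡ σ (θ w)) → ShapeIso σ u v
  ShapeIso-intro {u} {v} θ θ⁻ pres pres⁻ base θ⁻θ θθ⁻ shape = record
    { θ = θ ; θ⁻ = θ⁻
    ; θ-comp = θ-comp
    ; θ⁻-comp = λ w c → subst (λ t → InComp t (θ⁻ w)) θ⁻v≡u (InComp-map pres⁻ c)
    ; θ⁻θ = θ⁻θ ; θθ⁻ = θθ⁻
    ; edge-pres = pres
    ; edge-refl = λ i w w' c c' e → subst₂ (Edge i) (θ⁻θ w c) (θ⁻θ w' c')
        (pres⁻ i (θ w) (θ w') (θ-comp w c) (θ-comp w' c') e)
    ; shape = shape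
    ; base = base
    }
    where
    θ⁻v≡u : θ⁻ v ≡ u
    θ⁻v≡u = trans (cong θ⁻ (sym base)) (θ⁻θ u ε)
    θ-comp : ∀ w → InComp u w → InComp v (θ w)
    θ-comp w c = subst (λ t → InComp t (θ w)) base (InComp-map pres c)

  ShapeIso-SameWt : ∀ {u v} (I : ShapeIso σ u v) {w} → InComp u w → SameWt w (ShapeIso.θ I w)
  ShapeIso-SameWt I {w} c j = ≤-antisym (occ-≤-map edge-pres j c)
    (subst (occ j (θ w) ≤_) (cong (occ j) (θ⁻θ w c))
      (occ-≤-map (ShapeIso.edge-pres (ShapeIso-sym I)) j (θ-comp w c)))
    where open ShapeIso I

  module _ {u v u' v'} (I : ShapeIso σ u v) (J : ShapeIso σ u' v') where
    private
      module I = ShapeIso I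
      module J = ShapeIso J

    θ-++ : Word → Word
    θ-++ w = I.θ (take (length u) w) ++ J.θ (drop (length u) w)

    θ-++-split : ∀ {c} d → InComp u c → θ-++ (c ++ d) ≡ I.θ c ++ J.θ d
    θ-++-split {c} d cc rewrite sym (InComp-length cc) | take-length-++ c d | drop-length-++ c d = refl

    θ-++-Edge : ∀ {i a b c d} → InComp u a → InComp u' b → InComp u c → InComp u' d →
                Edge i (a ++ b) (c ++ d) → Edge i (I.θ a ++ J.θ b) (I.θ c ++ J.θ d)
    θ-++-Edge {i} {a} {b} {c} {d} ca cb cc cd e with Edge-++⁻ i a b e
    ... | onˡ {a'} e' o eq
          with ++-injective c a'
                 (trans (InComp-length cc) (trans (sym (InComp-length ca)) (sym (Edge-length i a e')))) eq
    ...   | refl , refl =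
      Edge-++ˡ i (I.θ a) (J.θ b) (I.edge-pres i a c ca cc e') (trans (sym (ShapeIso-SameWt J cb i)) o)
    θ-++-Edge {i} {a} {b} {c} {d} ca cb cc cd e | onʳ e' o eq
          with ++-injective c a (trans (InComp-length cc) (sym (InComp-length ca))) eq
    ...   | refl , refl =
      Edge-++ʳ i (I.θ a) (J.θ b) (J.edge-pres i b d cb cd e') (trans (sym (ShapeIso-SameWt I ca (suc i))) o)

    θ-++-EdgePreserving : EdgePreserving (u ++ u') θ-++
    θ-++-EdgePreserving i w w' cw cw' e with InComp-++⁻ u u' cw | InComp-++⁻ u u' cw'
    ... | a , b , refl , ca , cb | c , d , refl , cc , cd rewrite θ-++-split b ca | θ-++-split d cc =
      θ-++-Edge ca cb cc cd e

    θ-++-base : θ-++ (u ++ u') ≡ v ++ v'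
    θ-++-base = trans (θ-++-split u' ε) (cong₂ _++_ I.base J.base)

  θ-++-inverse : ∀ {u v u' v'} (I : ShapeIso σ u v) (J : ShapeIso σ u' v') →
                 ∀ w → InComp (u ++ u') w → θ-++ (ShapeIso-sym I) (ShapeIso-sym J) (θ-++ I J w) ≡ w
  θ-++-inverse {u} {u' = u'} I J w cw with InComp-++⁻ u u' cw
  ... | c , d , refl , cc , cd
    rewrite θ-++-split I J d cc
          | θ-++-split (ShapeIso-sym I) (ShapeIso-sym J) (ShapeIso.θ J d) (ShapeIso.θ-comp I c cc) =
    cong₂ _++_ (ShapeIso.θ⁻θ I c cc) (ShapeIso.θ⁻θ J d cd)

SameWt-++ : ∀ {p q r s} → SameWt p q → SameWt r s → SameWt (p ++ r) (q ++ s)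
SameWt-++ {p} {q} {r} {s} pq rs a =
  trans (occ-++ a p r) (trans (cong₂ _+_ (pq a) (rs a)) (sym (occ-++ a q s)))

module _ {S : Set} {σ : Word → S} (A : IsAbstractShape σ) where
  open IsAbstractShape A

  shape-++ʳ : ∀ {p q} r → SameWt p q → σ p ≡ σ q → σ (p ++ r) ≡ σ (q ++ r)
  shape-++ʳ {p} {q} []      _  e rewrite ++-identityʳ p | ++-identityʳ q = e
  shape-++ʳ {p} {q} (a ∷ r) pq e rewrite sym (++-assoc p [ a ] r) | sym (++-assoc q [ a ] r) =
    shape-++ʳ r (SameWt-++ {p} {q} {[ a ]} {[ a ]} pq λ _ → refl) (proj₁ (S2 p q a pq e))

  shape-++ˡ : ∀ {p q} r → SameWt p q → σ p ≡ σ q → σ (r ++ p) ≡ σ (r ++ q)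
  shape-++ˡ         []      _  e = e
  shape-++ˡ {p} {q} (a ∷ r) pq e =
    proj₂ (S2 (r ++ p) (r ++ q) a (SameWt-++ {r} {r} {p} {q} (λ _ → refl) pq) (shape-++ˡ r pq e))

  shape-++ : ∀ {p q r s} → SameWt p q → σ p ≡ σ q → SameWt r s → σ r ≡ σ s → σ (p ++ r) ≡ σ (q ++ s)
  shape-++ {q = q} {r} pq e rs e' = trans (shape-++ʳ r pq e) (shape-++ˡ q rs e')

  ShapeIso-++ : ∀ {u v u' v'} → ShapeIso σ u v → ShapeIso σ u' v' → ShapeIso σ (u ++ u') (v ++ v')
  ShapeIso-++ {u} {u' = u'} I J = ShapeIso-intro (θ-++ I J) (θ-++ (ShapeIso-sym I) (ShapeIso-sym J))
    (θ-++-EdgePreserving I J) (θ-++-EdgePreserving (ShapeIso-sym I) (ShapeIso-sym J))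
    (θ-++-base I J) (θ-++-inverse I J) (θ-++-inverse (ShapeIso-sym I) (ShapeIso-sym J)) shape
    where
    shape : ∀ w → InComp (u ++ u') w → σ w ≡ σ (θ-++ I J w)
    shape w cw with InComp-++⁻ u u' cw
    ... | c , d , refl , cc , cd rewrite θ-++-split I J d cc =
      shape-++ (ShapeIso-SameWt I cc) (ShapeIso.shape I c cc) (ShapeIso-SameWt J cd) (ShapeIso.shape J d cd)

proposition7 : {S : Set} (σ : Word → S) → IsAbstractShape σ → IsCongruence (λ u v → u ∼[ σ ] v)
proposition7 σ A = record
  { isEquivalence = record { refl = ShapeIso-refl ; sym = ShapeIso-sym ; trans = ShapeIso-trans }
  ; compatible = ShapeIso-++ A
  }
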